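{- Let $X$ be a set of $n$ cards, $a,b,c$ positive integers with $a+b+c=n$, $1\le\delta\le a$, and suppose Alice's $(a,b,c)$-strategy is $\gamma$-equitable. Then: (1) the strategy is weakly $\delta$-secure against Cathy if and only if for every $\delta'$ with $1\le\delta'\le\delta$, every announcement index $i$, every $H_C\in\binom{X}{c}$ with $\mathcal{P}(H_C,i)\neq\emptyset$, and all distinct $x_1,\dots,x_{\delta'}\in X\setminus H_C$, \[1\le |\{H_A\in\mathcal{P}(H_C,i): x_1,\dots,x_{\delta'}\in H_A\}|\le |\mathcal{P}(H_C,i)|-1;\] (2) the strategy is perfectly $\delta$-secure against Cathy if and only if for every announcement index $i$, every $H_C\in\binom{X}{c}$ with $\mathcal{P}(H_C,i)\neq\emptyset$, and all distinct $x_1,\dots,x_{\delta}\in X\setminus H_C$, \[|\{H_A\in\mathcal{P}(H_C,i): x_1,\dots,x_{\delta}\in H_A\}| = \frac{\binom{a}{\delta}\,|\mathcal{P}(H_C,i)|}{\binom{a+b}{\delta}}.\]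
   Context: An $(a,b,c)$-deal is a uniformly random partition of $X$ into Alice's hand $H_A$ ($a$ cards), Bob's hand $H_B$ ($b$ cards) and Cathy's hand $H_C$ ($c$ cards). $\binom{X}{t}$ denotes the set of $t$-subsets of $X$. An announcement is a subset of $\binom{X}{a}$. An $(a,b,c)$-strategy consists of announcements $\mathcal{A}_1,\dots,\mathcal{A}_m$ covering $\binom{X}{a}$ together with, for each $H_A$, a probability distribution $p_{H_A}$ with positive values on $g(H_A)=\{i : H_A\in\mathcal{A}_i\}$; Alice broadcasts an index $i$ chosen according to $p_{H_A}$. It is $\gamma$-equitable if $|g(H_A)|=\gamma$ for all $H_A$ and every $p_{H_A}$ is uniform. For $H\subseteq X$, $\mathcal{P}(H,i)=\{H_A\in\mathcal{A}_i : H_A\cap H=\emptyset\}$. For $1\le\delta\le a$: the strategy is weakly $\delta$-secure against Cathy if for every $\delta'$ with $1\le\delta'\le\delta$, every $i$, every $H_C\in\binom{X}{c}$ with $\mathcal{P}(H_C,i)\neq\emptyset$ and all distinct $x_1,\dots,x_{\delta'}\in X\setminus H_C$, $0<\Pr[x_1,\dots,x_{\delta'}\in H_A\mid i,H_C]<1$; it is perfectly $\delta$-secure against Cathy if under the same quantifiers $\Pr[x_1,\dots,x_{\delta'}\in H_A\mid i,H_C]=\binom{a}{\delta'}/\binom{a+b}{\delta'}$. Probabilities are over the random deal and Alice's random choice. -}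

module Defs where

open import Data.Nat as ℕ using (ℕ; zero; suc; _+_; _*_; _∸_)
open import Data.Nat.Combinatorics using (_C_)
open import Data.Bool using (Bool; true; false; _∧_; _∨_; not; T; if_then_else_)
open import Data.Fin as F using (Fin; zero; suc)
open import Data.Fin.Subset using (Subset; ∣_∣; _∉_)
open import Data.Vec as V using (Vec; []; _∷_)
open import Data.List as L using (List; []; _∷_; _++_; filter; length; allFin)
open import Data.Integer using (+_)
open import Data.Rational as Q using (ℚ; 0ℚ; 1ℚ; _<_)
import Data.Rational.Properties as QP
open import Data.Product using (Σ; ∃; ∃-syntax; _×_; _,_)
open import Function.Definitions using (Injective)
open import Relation.Binary.PropositionalEquality using (_≡_; _≢_)
open import Relation.Nullary using (¬_; yes; no)
open import Relation.Nullary.Decidable using (⌊_⌋)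

-- The card set X is Fin n; subsets of X are  Subset n = Vec Bool n.

allSubsets : (n : ℕ) → List (Subset n)
allSubsets zero = [] ∷ []
allSubsets (suc n) = L.map (true ∷_) (allSubsets n) ++ L.map (false ∷_) (allSubsets n)

disjB : ∀ {n} → Subset n → Subset n → Bool
disjB [] [] = true
disjB (x ∷ xs) (y ∷ ys) = not (x ∧ y) ∧ disjB xs ys

eqB : ∀ {n} → Subset n → Subset n → Bool
eqB [] [] = true
eqB (x ∷ xs) (y ∷ ys) = ((x ∧ y) ∨ (not x ∧ not y)) ∧ eqB xs ys

allInB : ∀ {n k} → (Fin k → Fin n) → Subset n → Bool
allInB {k = k} xs H = L.foldr _∧_ true (L.map (λ j → V.lookup H (xs j)) (allFin k))

-- Deals.  A deal is an assignment of an owner to every card: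
-- owner 0 = Alice, 1 = Bob, 2 = Cathy.

Owners : ℕ → Set
Owners n = Vec (Fin 3) n

allOwners : (n : ℕ) → List (Owners n)
allOwners zero = [] ∷ []
allOwners (suc n) =
  L.map (zero ∷_) (allOwners n) ++
  (L.map (suc zero ∷_) (allOwners n) ++ L.map (suc (suc zero) ∷_) (allOwners n))

hand : ∀ {n} → Fin 3 → Owners n → Subset n
hand o d = V.map (λ o' → ⌊ o F.≟ o' ⌋) d

handA handB handC : ∀ {n} → Owners n → Subset n
handA = hand zero
handB = hand (suc zero)
handC = hand (suc (suc zero))

deals : (n a b c : ℕ) → List (Owners n)
deals n a b c = filter (λ d → (∣ handA d ∣ ℕ.≟ a) Relation.Nullary.×-dec
                               ((∣ handB d ∣ ℕ.≟ b) Relation.Nullary.×-dec (∣ handC d ∣ ℕ.≟ c)))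
                       (allOwners n)

sumℚ : List ℚ → ℚ
sumℚ = L.foldr Q._+_ 0ℚ

-- p / q for natural numbers (the value for q = 0 is an irrelevant default)
ratio : ℕ → ℕ → ℚ
ratio p zero = 0ℚ
ratio p (suc q) = (+ p) Q./ suc q

-- conditional-probability quotient num / den (default 0 when den = 0)
divℚ : ℚ → ℚ → ℚ
divℚ num den with den QP.≟ 0ℚ
... | yes _ = 0ℚ
... | no den≢0 = Q._÷_ num den {{Q.≢-nonZero den≢0}}

record Strategy (n a : ℕ) : Set where
  field
    m     : ℕ                          -- number of announcements
    ann   : Fin m → Subset n → Bool    -- H ∈ 𝒜_i  iff  ann i H = true
    prob  : Subset n → Fin m → ℚ
    ann-size  : ∀ i H → T (ann i H) → ∣ H ∣ ≡ a
    ann-cover : ∀ H → ∣ H ∣ ≡ a → ∃[ i ] T (ann i H)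
    prob-pos  : ∀ H → ∣ H ∣ ≡ a → ∀ i → T (ann i H) → 0ℚ < prob H i
    prob-zero : ∀ H → ∣ H ∣ ≡ a → ∀ i → ¬ T (ann i H) → prob H i ≡ 0ℚ
    prob-sum  : ∀ H → ∣ H ∣ ≡ a → sumℚ (L.map (prob H) (allFin m)) ≡ 1ℚ

module _ {n a : ℕ} (S : Strategy n a) where
  open Strategy S

  g : Subset n → List (Fin m)
  g H = filter (λ i → T? (ann i H)) (allFin m)
    where
      T? : (b : Bool) → Relation.Nullary.Dec (T b)
      T? true = yes _
      T? false = no (λ ())

  Equitable : ℕ → Set
  Equitable γ = ∀ H → ∣ H ∣ ≡ a →
      length (g H) ≡ γ ×
      (∀ i j → T (ann i H) → T (ann j H) → prob H i ≡ prob H j)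

  𝒫 : Subset n → Fin m → List (Subset n)
  𝒫 H i = filter (λ HA → T? (ann i HA ∧ disjB HA H)) (allSubsets n)
    where
      T? : (b : Bool) → Relation.Nullary.Dec (T b)
      T? true = yes _
      T? false = no (λ ())

  count𝒫 : ∀ {k} → Subset n → Fin m → (Fin k → Fin n) → ℕ
  count𝒫 H i xs = length (filter (λ HA → T? (allInB xs HA)) (𝒫 H i))
    where
      T? : (b : Bool) → Relation.Nullary.Dec (T b)
      T? true = yes _
      T? false = no (λ ())

  module _ (b c : ℕ) where
    ind : Bool → ℚ
    ind true = 1ℚ
    ind false = 0ℚ

    -- Pr[E] where E is an event on (deal, announced index); the deal is
    -- uniform over all (a,b,c)-deals and the index is drawn from p_{H_A}.
    Pr : (Owners n → Fin m → Bool) → ℚ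
    Pr E = sumℚ (L.map (λ d → sumℚ (L.map (λ i →
              ind (E d i) Q.* (ratio 1 (length (deals n a b c)) Q.* prob (handA d) i))
              (allFin m))) (deals n a b c))

    condPr : ∀ {k} → (Fin k → Fin n) → Fin m → Subset n → ℚ
    condPr xs i HC = divℚ (Pr (λ d j → ⌊ i F.≟ j ⌋ ∧ eqB (handC d) HC ∧ allInB xs (handA d)))
                          (Pr (λ d j → ⌊ i F.≟ j ⌋ ∧ eqB (handC d) HC))

    WeaklySecure : ℕ → Set
    WeaklySecure δ = ∀ δ' → 1 ℕ.≤ δ' → δ' ℕ.≤ δ → ∀ i → ∀ (HC : Subset n) → ∣ HC ∣ ≡ c →
      𝒫 HC i ≢ [] → ∀ (xs : Fin δ' → Fin n) → Injective _≡_ _≡_ xs → (∀ j → xs j ∉ HC) →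
      0ℚ < condPr xs i HC × condPr xs i HC < 1ℚ

    PerfectlySecure : ℕ → Set
    PerfectlySecure δ = ∀ δ' → 1 ℕ.≤ δ' → δ' ℕ.≤ δ → ∀ i → ∀ (HC : Subset n) → ∣ HC ∣ ≡ c →
      𝒫 HC i ≢ [] → ∀ (xs : Fin δ' → Fin n) → Injective _≡_ _≡_ xs → (∀ j → xs j ∉ HC) →
      condPr xs i HC ≡ ratio (a C δ') ((a + b) C δ')

module Submission where

-- For an equitable strategy all hands of 𝒜ᵢ are announced as i with the same probability
-- 1/γ, and a deal in which Cathy holds H_C is determined by Alice's hand, which ranges over
-- the a-sets disjoint from H_C.  Hence Pr[x₁,…,x_δ' ∈ H_A | i, H_C] is the fraction of the
-- hands of 𝒫(H_C,i) containing x₁,…,x_δ', and both notions of security become counting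
-- conditions.  For perfect security the condition for δ' − 1 follows from the one for δ' by
-- double counting the pairs (H, x) with x a new card of H: each hand of 𝒫(H_C,i) containing
-- a given (δ'−1)-tuple has a − δ' + 1 such cards, and there are a + b − δ' + 1 candidates x.

open import Defs
open import Data.Bool using (Bool; true; false; _∧_; _∨_; not; T)
open import Data.Bool.Properties using (∧-zeroʳ; ∧-identityʳ)
open import Data.Empty using (⊥-elim)
open import Data.Fin as F using (Fin; zero; suc)
import Data.Fin.Properties as FP
open import Data.Fin.Subset using (Subset; ∣_∣; _∉_)
import Data.Integer as ℤ
import Data.Integer.Properties as ℤP
import Data.Integer.Tactic.RingSolver as ℤSolver
open import Data.List as L using (List; []; _∷_; _++_; filter; length)
import Data.List.Properties as LP
open import Data.Nat as ℕ using (ℕ; zero; suc; _+_; _*_; _∸_; _≤_; _<_; s≤s; z≤n)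
import Data.Nat.Tactic.RingSolver as ℕSolver
open import Data.Nat.Combinatorics using (_C_; nC1≡n; nCk+nC[k+1]≡[n+1]C[k+1]; k>n⇒nCk≡0)
import Data.Nat.Properties as ℕP
open import Data.Product using (_×_; _,_; proj₁; proj₂; ∃-syntax)
open import Data.Product.Function.NonDependent.Propositional using (_×-⇔_)
open import Data.Rational as Q using (ℚ; 0ℚ; 1ℚ)
import Data.Rational.Properties as QP
open import Data.Rational.Unnormalised as U using (mkℚᵘ; *≡*)
import Data.Rational.Unnormalised.Properties as UP
open import Data.Unit using (tt)
open import Data.Vec as V using ([]; _∷_)
import Data.Vec.Functional as VF
open import Data.Vec.Properties using ([]=⇒lookup; lookup⇒[]=)
open import Function.Bundles using (_⇔_; mk⇔; Equivalence)
open import Function.Definitions using (Injective)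
open import Relation.Binary.Definitions using (tri<; tri≈; tri>)
open import Relation.Binary.PropositionalEquality hiding ([_])
open import Relation.Nullary using (Dec; yes; no; does; ⌊_⌋; _×-dec_)
open import Relation.Nullary.Decidable using (dec-true; ⌊⌋-map′)

toℚ : ℕ → ℚ
toℚ n = ratio n 1

toℚᵘ-toℚ : ∀ n → Q.toℚᵘ (toℚ n) U.≃ mkℚᵘ (ℤ.+ n) 0
toℚᵘ-toℚ n = QP.toℚᵘ-fromℚᵘ (mkℚᵘ (ℤ.+ n) 0)

toℚ-+ : ∀ m n → toℚ (m + n) ≡ toℚ m Q.+ toℚ n
toℚ-+ m n = QP.toℚᵘ-injective (UP.≃-trans (toℚᵘ-toℚ (m + n)) (UP.≃-trans
  (*≡* (trans (cong (ℤ._* ℤ.+ 1) (ℤP.pos-+ m n)) (ℤ-lemma (ℤ.+ m) (ℤ.+ n))))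
  (UP.≃-sym (UP.≃-trans (QP.toℚᵘ-homo-+ (toℚ m) (toℚ n)) (UP.+-cong (toℚᵘ-toℚ m) (toℚᵘ-toℚ n))))))
  where
  ℤ-lemma : ∀ x y → (x ℤ.+ y) ℤ.* ℤ.+ 1 ≡ (x ℤ.* ℤ.+ 1 ℤ.+ y ℤ.* ℤ.+ 1) ℤ.* ℤ.+ 1
  ℤ-lemma = ℤSolver.solve-∀

toℚ-* : ∀ m n → toℚ (m * n) ≡ toℚ m Q.* toℚ n
toℚ-* m n = QP.toℚᵘ-injective (UP.≃-trans (toℚᵘ-toℚ (m * n)) (UP.≃-trans
  (*≡* (cong (ℤ._* ℤ.+ 1) (ℤP.pos-* m n)))
  (UP.≃-sym (UP.≃-trans (QP.toℚᵘ-homo-* (toℚ m) (toℚ n)) (UP.*-cong (toℚᵘ-toℚ m) (toℚᵘ-toℚ n))))))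

ratio-*-toℚ : ∀ p q → ratio p (suc q) Q.* toℚ (suc q) ≡ toℚ p
ratio-*-toℚ p q = QP.toℚᵘ-injective (UP.≃-trans (QP.toℚᵘ-homo-* (ratio p (suc q)) (toℚ (suc q)))
  (UP.≃-trans (UP.*-cong (QP.toℚᵘ-fromℚᵘ (mkℚᵘ (ℤ.+ p) q)) (toℚᵘ-toℚ (suc q)))
  (UP.≃-trans (*≡* (trans (ℤ-lemma (ℤ.+ p) (ℤ.+ suc q)) (cong (λ k → ℤ.+ p ℤ.* ℤ.+ suc k) (sym (ℕP.*-identityʳ q)))))
  (UP.≃-sym (toℚᵘ-toℚ p)))))
  where
  ℤ-lemma : ∀ x y → (x ℤ.* y) ℤ.* ℤ.+ 1 ≡ x ℤ.* y
  ℤ-lemma = ℤSolver.solve-∀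

toℚ-mono-< : ∀ {m n} → m < n → toℚ m Q.< toℚ n
toℚ-mono-< {m} {n} m<n = QP.toℚᵘ-cancel-<
  (UP.<-respˡ-≃ (UP.≃-sym (toℚᵘ-toℚ m)) (UP.<-respʳ-≃ (UP.≃-sym (toℚᵘ-toℚ n))
    (U.*<* (subst₂ ℤ._<_ (sym (ℤP.*-identityʳ (ℤ.+ m))) (sym (ℤP.*-identityʳ (ℤ.+ n))) (ℤ.+<+ m<n)))))

toℚ-cancel-< : ∀ {m n} → toℚ m Q.< toℚ n → m < n
toℚ-cancel-< {m} {n} lt = ℤP.drop‿+<+ (subst₂ ℤ._<_ (ℤP.*-identityʳ (ℤ.+ m)) (ℤP.*-identityʳ (ℤ.+ n))
  (UP.drop-*<* (UP.<-respˡ-≃ (toℚᵘ-toℚ m) (UP.<-respʳ-≃ (toℚᵘ-toℚ n) (QP.toℚᵘ-mono-< lt)))))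

toℚ-injective : ∀ {m n} → toℚ m ≡ toℚ n → m ≡ n
toℚ-injective {m} {n} e with ℕP.<-cmp m n
... | tri< lt _ _ = ⊥-elim (QP.<-irrefl e (toℚ-mono-< lt))
... | tri≈ _ eq _ = eq
... | tri> _ _ gt = ⊥-elim (QP.<-irrefl (sym e) (toℚ-mono-< gt))

toℚ-suc≢0 : ∀ n → toℚ (suc n) ≢ 0ℚ
toℚ-suc≢0 n e = QP.<-irrefl (sym e) (toℚ-mono-< (s≤s (z≤n {n})))

divℚ-*-cancel : ∀ p q → q ≢ 0ℚ → divℚ p q Q.* q ≡ p
divℚ-*-cancel p q q≢0 with q QP.≟ 0ℚ
... | yes q≡0 = ⊥-elim (q≢0 q≡0)
... | no q≢0' = trans (QP.*-assoc p (Q.1/_ q {{Q.≢-nonZero q≢0'}}) q)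
  (trans (cong (p Q.*_) (QP.*-inverseˡ q {{Q.≢-nonZero q≢0'}})) (QP.*-identityʳ p))

*-cancelʳ-≡ : ∀ p q r → r ≢ 0ℚ → p Q.* r ≡ q Q.* r → p ≡ q
*-cancelʳ-≡ p q r r≢0 e = begin
  p                      ≡⟨ sym (QP.*-identityʳ p) ⟩
  p Q.* 1ℚ               ≡⟨ cong (p Q.*_) (sym r*r⁻¹≡1) ⟩
  p Q.* (r Q.* r⁻¹)      ≡⟨ sym (QP.*-assoc p r r⁻¹) ⟩
  (p Q.* r) Q.* r⁻¹      ≡⟨ cong (Q._* r⁻¹) e ⟩
  (q Q.* r) Q.* r⁻¹      ≡⟨ QP.*-assoc q r r⁻¹ ⟩
  q Q.* (r Q.* r⁻¹)      ≡⟨ cong (q Q.*_) r*r⁻¹≡1 ⟩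
  q Q.* 1ℚ               ≡⟨ QP.*-identityʳ q ⟩
  q                      ∎
  where
  open ≡-Reasoning
  r⁻¹ = Q.1/_ r {{Q.≢-nonZero r≢0}}
  r*r⁻¹≡1 : r Q.* r⁻¹ ≡ 1ℚ
  r*r⁻¹≡1 = QP.*-inverseʳ r {{Q.≢-nonZero r≢0}}

*-≢0 : ∀ {p q} → p ≢ 0ℚ → q ≢ 0ℚ → p Q.* q ≢ 0ℚ
*-≢0 {p} {q} p≢0 q≢0 pq≡0 = p≢0 (*-cancelʳ-≡ p 0ℚ q q≢0 (trans pq≡0 (sym (QP.*-zeroˡ q))))

divℚ-scaled : ∀ p q w → q ≢ 0ℚ → w ≢ 0ℚ → divℚ (p Q.* w) (q Q.* w) Q.* q ≡ p
divℚ-scaled p q w q≢0 w≢0 = *-cancelʳ-≡ _ p w w≢0 (begin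
  divℚ (p Q.* w) (q Q.* w) Q.* q Q.* w     ≡⟨ QP.*-assoc (divℚ (p Q.* w) (q Q.* w)) q w ⟩
  divℚ (p Q.* w) (q Q.* w) Q.* (q Q.* w)   ≡⟨ divℚ-*-cancel (p Q.* w) (q Q.* w) (*-≢0 q≢0 w≢0) ⟩
  p Q.* w                                 ∎)
  where open ≡-Reasoning

ratio-1-≢0 : ∀ {N} → 1 ≤ N → ratio 1 N ≢ 0ℚ
ratio-1-≢0 {suc N} _ r≡0 = QP.1≢0 (trans (sym (ratio-*-toℚ 1 N)) (trans (cong (Q._* toℚ (suc N)) r≡0) (QP.*-zeroˡ (toℚ (suc N)))))

module Quotient (X Y : ℕ) (q : ℚ) (q*[1+Y]≡X : q Q.* toℚ (suc Y) ≡ toℚ X) where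

  private
    instance
      [1+Y]-pos : Q.Positive (toℚ (suc Y))
      [1+Y]-pos = Q.positive (toℚ-mono-< (s≤s (z≤n {Y})))
      [1+Y]-nonNeg : Q.NonNegative (toℚ (suc Y))
      [1+Y]-nonNeg = QP.pos⇒nonNeg (toℚ (suc Y))

  0<q⇔1≤X : 0ℚ Q.< q ⇔ 1 ≤ X
  0<q⇔1≤X = mk⇔
    (λ 0<q → toℚ-cancel-< (subst₂ Q._<_ (QP.*-zeroˡ (toℚ (suc Y))) q*[1+Y]≡X
      (QP.*-monoˡ-<-pos (toℚ (suc Y)) 0<q)))
    (λ 1≤X → QP.*-cancelʳ-<-nonNeg (toℚ (suc Y)) (subst₂ Q._<_ (sym (QP.*-zeroˡ (toℚ (suc Y))))
      (sym q*[1+Y]≡X) (toℚ-mono-< 1≤X)))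

  q<1⇔X≤Y : q Q.< 1ℚ ⇔ X ≤ Y
  q<1⇔X≤Y = mk⇔
    (λ q<1 → ℕP.≤-pred (toℚ-cancel-< (subst₂ Q._<_ q*[1+Y]≡X (QP.*-identityˡ (toℚ (suc Y)))
      (QP.*-monoˡ-<-pos (toℚ (suc Y)) q<1))))
    (λ X≤Y → QP.*-cancelʳ-<-nonNeg (toℚ (suc Y)) (subst₂ Q._<_ (sym q*[1+Y]≡X)
      (sym (QP.*-identityˡ (toℚ (suc Y)))) (toℚ-mono-< (s≤s X≤Y))))

  q≡ratio⇔ : ∀ A B → q ≡ ratio A (suc B) ⇔ X * suc B ≡ A * suc Y
  q≡ratio⇔ A B = mk⇔
    (λ q≡A/B → toℚ-injective (begin
      toℚ (X * suc B)                             ≡⟨ toℚ-* X (suc B) ⟩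
      toℚ X Q.* toℚ (suc B)                       ≡⟨ cong (Q._* toℚ (suc B)) (sym q*[1+Y]≡X) ⟩
      q Q.* toℚ (suc Y) Q.* toℚ (suc B)           ≡⟨ cong (λ t → t Q.* toℚ (suc Y) Q.* toℚ (suc B)) q≡A/B ⟩
      A/B Q.* toℚ (suc Y) Q.* toℚ (suc B)         ≡⟨ swap A/B (toℚ (suc Y)) (toℚ (suc B)) ⟩
      A/B Q.* toℚ (suc B) Q.* toℚ (suc Y)         ≡⟨ cong (Q._* toℚ (suc Y)) (ratio-*-toℚ A B) ⟩
      toℚ A Q.* toℚ (suc Y)                       ≡⟨ sym (toℚ-* A (suc Y)) ⟩
      toℚ (A * suc Y)                             ∎))
    (λ X[1+B]≡A[1+Y] → *-cancelʳ-≡ q A/B (toℚ (suc B))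
      (toℚ-suc≢0 B)
      (*-cancelʳ-≡ (q Q.* toℚ (suc B)) (A/B Q.* toℚ (suc B)) (toℚ (suc Y)) (toℚ-suc≢0 Y) (begin
        q Q.* toℚ (suc B) Q.* toℚ (suc Y)         ≡⟨ swap q (toℚ (suc B)) (toℚ (suc Y)) ⟩
        q Q.* toℚ (suc Y) Q.* toℚ (suc B)         ≡⟨ cong (Q._* toℚ (suc B)) q*[1+Y]≡X ⟩
        toℚ X Q.* toℚ (suc B)                     ≡⟨ sym (toℚ-* X (suc B)) ⟩
        toℚ (X * suc B)                           ≡⟨ cong toℚ X[1+B]≡A[1+Y] ⟩
        toℚ (A * suc Y)                           ≡⟨ toℚ-* A (suc Y) ⟩
        toℚ A Q.* toℚ (suc Y)                     ≡⟨ cong (Q._* toℚ (suc Y)) (sym (ratio-*-toℚ A B)) ⟩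
        A/B Q.* toℚ (suc B) Q.* toℚ (suc Y)       ∎)))
    where
    open ≡-Reasoning
    A/B = ratio A (suc B)
    swap : ∀ x y z → x Q.* y Q.* z ≡ x Q.* z Q.* y
    swap x y z = trans (QP.*-assoc x y z) (trans (cong (x Q.*_) (QP.*-comm y z)) (sym (QP.*-assoc x z y)))

[_] : Bool → ℕ
[ true ] = 1
[ false ] = 0

Σᴸ : {A : Set} → (A → ℕ) → List A → ℕ
Σᴸ f [] = 0
Σᴸ f (x ∷ xs) = f x + Σᴸ f xs

count : {A : Set} → (A → Bool) → List A → ℕ
count f = Σᴸ (λ x → [ f x ])

module _ {A : Set} where

  Σᴸ-++ : (f : A → ℕ) (xs ys : List A) → Σᴸ f (xs ++ ys) ≡ Σᴸ f xs + Σᴸ f ys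
  Σᴸ-++ f [] ys = refl
  Σᴸ-++ f (x ∷ xs) ys = trans (cong (f x +_) (Σᴸ-++ f xs ys)) (sym (ℕP.+-assoc (f x) _ _))

  Σᴸ-map : {B : Set} (f : B → ℕ) (g : A → B) (xs : List A) → Σᴸ f (L.map g xs) ≡ Σᴸ (λ x → f (g x)) xs
  Σᴸ-map f g [] = refl
  Σᴸ-map f g (x ∷ xs) = cong (f (g x) +_) (Σᴸ-map f g xs)

  Σᴸ-cong : {f g : A → ℕ} → (∀ x → f x ≡ g x) → (xs : List A) → Σᴸ f xs ≡ Σᴸ g xs
  Σᴸ-cong e [] = refl
  Σᴸ-cong e (x ∷ xs) = cong₂ _+_ (e x) (Σᴸ-cong e xs)

  Σᴸ-*ʳ : (f : A → Bool) (k : ℕ) (xs : List A) → Σᴸ (λ x → [ f x ] * k) xs ≡ count f xs * k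
  Σᴸ-*ʳ f k [] = refl
  Σᴸ-*ʳ f k (x ∷ xs) = trans (cong ([ f x ] * k +_) (Σᴸ-*ʳ f k xs)) (sym (ℕP.*-distribʳ-+ k [ f x ] (count f xs)))

  count-cong : {f g : A → Bool} → (∀ x → f x ≡ g x) → (xs : List A) → count f xs ≡ count g xs
  count-cong e = Σᴸ-cong (λ x → cong [_] (e x))

  count-false : {f : A → Bool} → (∀ x → f x ≡ false) → (xs : List A) → count f xs ≡ 0
  count-false e [] = refl
  count-false e (x ∷ xs) = cong₂ _+_ (cong [_] (e x)) (count-false e xs)

  none : List A → ℕ
  none = count (λ _ → false)

  count-none : (xs : List A) → none xs ≡ 0
  count-none = count-false (λ _ → refl)

  count-∧ˡ : (b : Bool) (f : A → Bool) (xs : List A) → [ b ] * count f xs ≡ count (λ x → b ∧ f x) xs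
  count-∧ˡ true f xs = ℕP.+-identityʳ _
  count-∧ˡ false f xs = sym (count-false (λ _ → refl) xs)

  count≤length : (f : A → Bool) (xs : List A) → count f xs ≤ length xs
  count≤length f [] = z≤n
  count≤length f (x ∷ xs) with f x
  ... | true = s≤s (count≤length f xs)
  ... | false = ℕP.m≤n⇒m≤1+n (count≤length f xs)

  count-filter : {P : A → Set} (D : ∀ x → Dec (P x)) (g : A → Bool) (xs : List A) →
    count g (filter D xs) ≡ count (λ x → does (D x) ∧ g x) xs
  count-filter D g [] = refl
  count-filter D g (x ∷ xs) with does (D x)
  ... | true = cong ([ g x ] +_) (count-filter D g xs)
  ... | false = count-filter D g xs

  does-T : (f : A → Bool) (D : ∀ x → Dec (T (f x))) → ∀ x → does (D x) ≡ f x
  does-T f D x with f x | D x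
  ... | true | yes _ = refl
  ... | true | no ¬t = ⊥-elim (¬t tt)
  ... | false | no _ = refl

  length-filter-T : (f : A → Bool) (D : ∀ x → Dec (T (f x))) (xs : List A) → length (filter D xs) ≡ count f xs
  length-filter-T f D [] = refl
  length-filter-T f D (x ∷ xs) rewrite does-T f D x with f x
  ... | true = cong suc (length-filter-T f D xs)
  ... | false = length-filter-T f D xs

  count-filter-T : (f : A → Bool) (D : ∀ x → Dec (T (f x))) (g : A → Bool) (xs : List A) →
    count g (filter D xs) ≡ count (λ x → f x ∧ g x) xs
  count-filter-T f D g xs = trans (count-filter D g xs) (count-cong (λ x → cong (_∧ g x) (does-T f D x)) xs)

  filter-head : {P : A → Set} (D : ∀ x → Dec (P x)) (xs : List A) {h : A} {t : List A} →
    filter D xs ≡ h ∷ t → P h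
  filter-head D (x ∷ xs) e with D x
  filter-head D (x ∷ xs) refl | yes p = p
  ... | no _ = filter-head D xs e

Σᶠ : ∀ {n} → (Fin n → ℕ) → ℕ
Σᶠ {zero} f = 0
Σᶠ {suc n} f = f zero + Σᶠ (λ z → f (suc z))

countᶠ : ∀ {n} → (Fin n → Bool) → ℕ
countᶠ f = Σᶠ (λ z → [ f z ])

Σᶠ-cong : ∀ {n} {f g : Fin n → ℕ} → (∀ z → f z ≡ g z) → Σᶠ f ≡ Σᶠ g
Σᶠ-cong {zero} e = refl
Σᶠ-cong {suc n} e = cong₂ _+_ (e zero) (Σᶠ-cong (λ z → e (suc z)))

Σᶠ-zero : ∀ {n} {f : Fin n → ℕ} → (∀ z → f z ≡ 0) → Σᶠ f ≡ 0
Σᶠ-zero {zero} e = refl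
Σᶠ-zero {suc n} e = cong₂ _+_ (e zero) (Σᶠ-zero (λ z → e (suc z)))

Σᶠ-+ : ∀ {n} (f g : Fin n → ℕ) → Σᶠ (λ z → f z + g z) ≡ Σᶠ f + Σᶠ g
Σᶠ-+ {zero} f g = refl
Σᶠ-+ {suc n} f g = trans (cong (f zero + g zero +_) (Σᶠ-+ (λ z → f (suc z)) (λ z → g (suc z))))
  (interchange (f zero) (g zero) (Σᶠ (λ z → f (suc z))) (Σᶠ (λ z → g (suc z))))
  where
  interchange : ∀ x y u v → x + y + (u + v) ≡ x + u + (y + v)
  interchange = ℕSolver.solve-∀

Σᶠ-*ʳ : ∀ {n} (f : Fin n → ℕ) (k : ℕ) → Σᶠ (λ z → f z * k) ≡ Σᶠ f * k
Σᶠ-*ʳ {zero} f k = refl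
Σᶠ-*ʳ {suc n} f k = trans (cong (f zero * k +_) (Σᶠ-*ʳ (λ z → f (suc z)) k)) (sym (ℕP.*-distribʳ-+ k (f zero) _))

Σᶠ-Σᴸ-comm : ∀ {n} {A : Set} (g : Fin n → A → ℕ) (xs : List A) →
  Σᶠ (λ z → Σᴸ (g z) xs) ≡ Σᴸ (λ x → Σᶠ (λ z → g z x)) xs
Σᶠ-Σᴸ-comm {n} g [] = Σᶠ-zero {n} (λ _ → refl)
Σᶠ-Σᴸ-comm g (x ∷ xs) = trans (Σᶠ-+ (λ z → g z x) (λ z → Σᴸ (g z) xs)) (cong (Σᶠ (λ z → g z x) +_) (Σᶠ-Σᴸ-comm g xs))

∣∣≡countᶠ : ∀ {n} (H : Subset n) → ∣ H ∣ ≡ countᶠ (V.lookup H)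
∣∣≡countᶠ [] = refl
∣∣≡countᶠ (true ∷ H) = cong suc (∣∣≡countᶠ H)
∣∣≡countᶠ (false ∷ H) = ∣∣≡countᶠ H

countᶠ-not : ∀ {n} (f : Fin n → Bool) → countᶠ f + countᶠ (λ z → not (f z)) ≡ n
countᶠ-not {zero} f = refl
countᶠ-not {suc n} f with f zero
... | true = cong suc (countᶠ-not (λ z → f (suc z)))
... | false = trans (ℕP.+-suc _ _) (cong suc (countᶠ-not (λ z → f (suc z))))

countᶠ-remove : ∀ {n} (f : Fin n → Bool) (y : Fin n) →
  countᶠ f ≡ countᶠ (λ z → f z ∧ not (does (y F.≟ z))) + [ f y ]
countᶠ-remove {suc n} f zero = trans (ℕP.+-comm [ f zero ] _)
  (cong₂ _+_ (trans (Σᶠ-cong (λ z → cong [_] (sym (∧-identityʳ (f (suc z))))))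
                    (cong (_+ countᶠ (λ z → f (suc z) ∧ true)) (cong [_] (sym (∧-zeroʳ (f zero))))))
             refl)
countᶠ-remove {suc n} f (suc y) = trans (cong₂ _+_ (cong [_] (sym (∧-identityʳ (f zero)))) (countᶠ-remove (λ z → f (suc z)) y))
  (sym (ℕP.+-assoc [ f zero ∧ true ] _ _))

-- Deals with a prescribed hand for Cathy

others : ∀ {n} → Subset n → Subset n → Subset n
others [] [] = []
others (x ∷ xs) (y ∷ ys) = (not x ∧ not y) ∷ others xs ys

count-allOwners : ∀ {n} (f : Owners (suc n) → Bool) → count f (allOwners (suc n)) ≡
  count (λ d → f (zero ∷ d)) (allOwners n) +
  (count (λ d → f (suc zero ∷ d)) (allOwners n) + count (λ d → f (suc (suc zero) ∷ d)) (allOwners n))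
count-allOwners {n} f = trans (Σᴸ-++ _ (L.map (zero ∷_) (allOwners n)) _)
  (cong₂ _+_ (Σᴸ-map _ _ (allOwners n))
    (trans (Σᴸ-++ _ (L.map (suc zero ∷_) (allOwners n)) _)
      (cong₂ _+_ (Σᴸ-map _ _ (allOwners n)) (Σᴸ-map _ _ (allOwners n)))))

count-allSubsets : ∀ {n} (f : Subset (suc n) → Bool) → count f (allSubsets (suc n)) ≡
  count (λ H → f (true ∷ H)) (allSubsets n) + count (λ H → f (false ∷ H)) (allSubsets n)
count-allSubsets {n} f = trans (Σᴸ-++ _ (L.map (true ∷_) (allSubsets n)) _)
  (cong₂ _+_ (Σᴸ-map _ _ (allSubsets n)) (Σᴸ-map _ _ (allSubsets n)))

deal? : ∀ {n} → (Subset n → Subset n → Bool) → Subset n → Owners n → Bool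
deal? Φ HC d = eqB (handC d) HC ∧ Φ (handA d) (handB d)

hand? : ∀ {n} → (Subset n → Subset n → Bool) → Subset n → Subset n → Bool
hand? Φ HC H = disjB H HC ∧ Φ H (others H HC)

count-owners≡count-hands : ∀ {n} (HC : Subset n) (Φ : Subset n → Subset n → Bool) →
  count (deal? Φ HC) (allOwners n) ≡ count (hand? Φ HC) (allSubsets n)
count-owners≡count-hands [] Φ = refl
count-owners≡count-hands {suc n} (true ∷ HC) Φ = begin
  count (deal? Φ (true ∷ HC)) (allOwners (suc n))
    ≡⟨ count-allOwners (deal? Φ (true ∷ HC)) ⟩
  none (allOwners n) + (none (allOwners n) + count (deal? (λ A B → Φ (false ∷ A) (false ∷ B)) HC) (allOwners n))
    ≡⟨ cong₂ _+_ (count-none (allOwners n)) (cong₂ _+_ (count-none (allOwners n)) refl) ⟩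
  count (deal? (λ A B → Φ (false ∷ A) (false ∷ B)) HC) (allOwners n)
    ≡⟨ count-owners≡count-hands HC (λ A B → Φ (false ∷ A) (false ∷ B)) ⟩
  count (hand? (λ A B → Φ (false ∷ A) (false ∷ B)) HC) (allSubsets n)
    ≡⟨ cong₂ _+_ (count-none (allSubsets n)) refl ⟨
  none (allSubsets n) + count (hand? (λ A B → Φ (false ∷ A) (false ∷ B)) HC) (allSubsets n)
    ≡⟨ count-allSubsets (hand? Φ (true ∷ HC)) ⟨
  count (hand? Φ (true ∷ HC)) (allSubsets (suc n))
    ∎
  where open ≡-Reasoning
count-owners≡count-hands {suc n} (false ∷ HC) Φ = begin
  count (deal? Φ (false ∷ HC)) (allOwners (suc n))
    ≡⟨ count-allOwners (deal? Φ (false ∷ HC)) ⟩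
  count (deal? (λ A B → Φ (true ∷ A) (false ∷ B)) HC) (allOwners n) +
    (count (deal? (λ A B → Φ (false ∷ A) (true ∷ B)) HC) (allOwners n) + none (allOwners n))
    ≡⟨ cong₂ _+_ (count-owners≡count-hands HC (λ A B → Φ (true ∷ A) (false ∷ B)))
                 (trans (cong₂ _+_ (count-owners≡count-hands HC (λ A B → Φ (false ∷ A) (true ∷ B)))
                                   (count-none (allOwners n)))
                        (ℕP.+-identityʳ _)) ⟩
  count (hand? (λ A B → Φ (true ∷ A) (false ∷ B)) HC) (allSubsets n) +
    count (hand? (λ A B → Φ (false ∷ A) (true ∷ B)) HC) (allSubsets n)
    ≡⟨ count-allSubsets (hand? Φ (false ∷ HC)) ⟨
  count (hand? Φ (false ∷ HC)) (allSubsets (suc n))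
    ∎
  where open ≡-Reasoning

eqB⇒≡ : ∀ {n} (A B : Subset n) → eqB A B ≡ true → A ≡ B
eqB⇒≡ [] [] _ = refl
eqB⇒≡ (true ∷ A) (true ∷ B) e = cong (true ∷_) (eqB⇒≡ A B e)
eqB⇒≡ (false ∷ A) (false ∷ B) e = cong (false ∷_) (eqB⇒≡ A B e)

∣∣-others : ∀ {n} (H HC : Subset n) → disjB H HC ≡ true → ∣ H ∣ + ∣ HC ∣ + ∣ others H HC ∣ ≡ n
∣∣-others [] [] e = refl
∣∣-others (true ∷ H) (false ∷ HC) e = cong suc (∣∣-others H HC e)
∣∣-others (false ∷ H) (true ∷ HC) e =
  trans (cong (_+ ∣ others H HC ∣) (ℕP.+-suc ∣ H ∣ ∣ HC ∣)) (cong suc (∣∣-others H HC e))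
∣∣-others (false ∷ H) (false ∷ HC) e = trans (ℕP.+-suc (∣ H ∣ + ∣ HC ∣) _) (cong suc (∣∣-others H HC e))

-- the decider of Defs.deals, so that deals n a b c is filter (sized? a b c) (allOwners n) by definition
sized? : ∀ {n} (a b c : ℕ) (d : Owners n) → Dec ((∣ handA d ∣ ≡ a) × ((∣ handB d ∣ ≡ b) × (∣ handC d ∣ ≡ c)))
sized? a b c d = (∣ handA d ∣ ℕ.≟ a) ×-dec ((∣ handB d ∣ ℕ.≟ b) ×-dec (∣ handC d ∣ ℕ.≟ c))

count-deals≡count-hands : ∀ {n a b c} (HC : Subset n) (Ψ : Subset n → Bool) →
  a + b + c ≡ n → ∣ HC ∣ ≡ c → (∀ H → Ψ H ≡ true → ∣ H ∣ ≡ a) →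
  count (λ d → eqB (handC d) HC ∧ Ψ (handA d)) (deals n a b c) ≡ count (λ H → disjB H HC ∧ Ψ H) (allSubsets n)
count-deals≡count-hands {n} {a} {b} {c} HC Ψ a+b+c≡n ∣HC∣≡c Ψ⇒∣∣≡a = begin
  count (λ d → eqB (handC d) HC ∧ Ψ (handA d)) (filter (sized? a b c) (allOwners n))
    ≡⟨ count-filter (sized? a b c) _ (allOwners n) ⟩
  count (λ d → does (sized? a b c d) ∧ (eqB (handC d) HC ∧ Ψ (handA d))) (allOwners n)
    ≡⟨ count-cong on-deals (allOwners n) ⟩
  count (deal? Φ HC) (allOwners n)
    ≡⟨ count-owners≡count-hands HC Φ ⟩
  count (hand? Φ HC) (allSubsets n)
    ≡⟨ count-cong on-hands (allSubsets n) ⟩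
  count (λ H → disjB H HC ∧ Ψ H) (allSubsets n)
    ∎
  where
  open ≡-Reasoning
  Φ : Subset n → Subset n → Bool
  Φ A B = (does (∣ A ∣ ℕ.≟ a) ∧ (does (∣ B ∣ ℕ.≟ b) ∧ does (∣ HC ∣ ℕ.≟ c))) ∧ Ψ A
  on-deals : ∀ d → does (sized? a b c d) ∧ (eqB (handC d) HC ∧ Ψ (handA d)) ≡ deal? Φ HC d
  on-deals d with eqB (handC d) HC in e
  ... | false = ∧-zeroʳ (does (sized? a b c d))
  ... | true rewrite eqB⇒≡ (handC d) HC e = refl
  on-hands : ∀ H → hand? Φ HC H ≡ disjB H HC ∧ Ψ H
  on-hands H with disjB H HC in disj | Ψ H in ψ
  ... | false | _ = refl
  ... | true | false = ∧-zeroʳ _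
  ... | true | true = cong (_∧ true) (cong₂ _∧_ (dec-true (∣ H ∣ ℕ.≟ a) ∣H∣≡a)
                        (cong₂ _∧_ (dec-true (∣ others H HC ∣ ℕ.≟ b) ∣others∣≡b) (dec-true (∣ HC ∣ ℕ.≟ c) ∣HC∣≡c)))
    where
    ∣H∣≡a : ∣ H ∣ ≡ a
    ∣H∣≡a = Ψ⇒∣∣≡a H ψ
    swap-middle : ∀ x y z → x + y + z ≡ x + z + y
    swap-middle = ℕSolver.solve-∀
    ∣others∣≡b : ∣ others H HC ∣ ≡ b
    ∣others∣≡b = ℕP.+-cancelˡ-≡ (a + c) _ _ (begin
      a + c + ∣ others H HC ∣           ≡⟨ cong₂ (λ x y → x + y + ∣ others H HC ∣) (sym ∣H∣≡a) (sym ∣HC∣≡c) ⟩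
      ∣ H ∣ + ∣ HC ∣ + ∣ others H HC ∣   ≡⟨ ∣∣-others H HC disj ⟩
      n                                 ≡⟨ sym a+b+c≡n ⟩
      a + b + c                         ≡⟨ swap-middle a b c ⟩
      a + c + b                         ∎)

_∈ᵇ_ : ∀ {n k} → Fin n → (Fin k → Fin n) → Bool
_∈ᵇ_ {k = zero} z ys = false
_∈ᵇ_ {k = suc k} z ys = does (ys zero F.≟ z) ∨ (z ∈ᵇ VF.tail ys)

∈ᵇ-false : ∀ {n k} (z : Fin n) (ys : Fin k → Fin n) → (∀ j → ys j ≢ z) → z ∈ᵇ ys ≡ false
∈ᵇ-false {k = zero} z ys ne = refl
∈ᵇ-false {k = suc k} z ys ne with ys zero F.≟ z
... | yes e = ⊥-elim (ne zero e)
... | no _ = ∈ᵇ-false z (VF.tail ys) (λ j → ne (suc j))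

∈ᵇ-false⁻ : ∀ {n k} (z : Fin n) (ys : Fin k → Fin n) → z ∈ᵇ ys ≡ false → ∀ j → ys j ≢ z
∈ᵇ-false⁻ {k = suc k} z ys m j e with ys zero F.≟ z
∈ᵇ-false⁻ {k = suc k} z ys () j e | yes _
∈ᵇ-false⁻ {k = suc k} z ys m zero e | no ne = ne e
∈ᵇ-false⁻ {k = suc k} z ys m (suc j) e | no ne = ∈ᵇ-false⁻ z (VF.tail ys) m j e

∷-injective : ∀ {n k} (z : Fin n) (ys : Fin k → Fin n) → Injective _≡_ _≡_ ys → z ∈ᵇ ys ≡ false →
  Injective _≡_ _≡_ (z VF.∷ ys)
∷-injective z ys inj z∉ys {zero} {zero} e = refl
∷-injective z ys inj z∉ys {zero} {suc j} e = ⊥-elim (∈ᵇ-false⁻ z ys z∉ys j (sym e))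
∷-injective z ys inj z∉ys {suc i} {zero} e = ⊥-elim (∈ᵇ-false⁻ z ys z∉ys i e)
∷-injective z ys inj z∉ys {suc i} {suc j} e = cong suc (inj e)

countᶠ-∖-distinct : ∀ {n k} (U : Fin n → Bool) (ys : Fin k → Fin n) → Injective _≡_ _≡_ ys →
  (∀ j → U (ys j) ≡ true) → countᶠ (λ z → U z ∧ not (z ∈ᵇ ys)) + k ≡ countᶠ U
countᶠ-∖-distinct {k = zero} U ys inj ys⊆U =
  trans (ℕP.+-identityʳ _) (Σᶠ-cong (λ z → cong [_] (∧-identityʳ (U z))))
countᶠ-∖-distinct {n} {suc k} U ys inj ys⊆U = begin
  countᶠ (λ z → U z ∧ not (z ∈ᵇ ys)) + suc k
    ≡⟨ cong (_+ suc k) (Σᶠ-cong (λ z → cong [_] (not-∨ (U z) (does (y F.≟ z)) (z ∈ᵇ ys')))) ⟩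
  countᶠ (λ z → U' z ∧ not (does (y F.≟ z))) + suc k
    ≡⟨ ℕP.+-assoc _ 1 k ⟨
  countᶠ (λ z → U' z ∧ not (does (y F.≟ z))) + [ true ] + k
    ≡⟨ cong (λ t → countᶠ (λ z → U' z ∧ not (does (y F.≟ z))) + [ t ] + k) U'y ⟨
  countᶠ (λ z → U' z ∧ not (does (y F.≟ z))) + [ U' y ] + k
    ≡⟨ cong (_+ k) (countᶠ-remove U' y) ⟨
  countᶠ U' + k
    ≡⟨ countᶠ-∖-distinct U ys' (λ e → FP.suc-injective (inj e)) (λ j → ys⊆U (suc j)) ⟩
  countᶠ U
    ∎
  where
  open ≡-Reasoning
  y = ys zero
  ys' = VF.tail ys
  U' : Fin n → Bool
  U' z = U z ∧ not (z ∈ᵇ ys')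
  U'y : U' y ≡ true
  U'y = cong₂ (λ u m → u ∧ not m) (ys⊆U zero) (∈ᵇ-false y ys' (λ j e → FP.0≢1+n (inj (sym e))))
  not-∨ : ∀ u x w → u ∧ not (x ∨ w) ≡ (u ∧ not w) ∧ not x
  not-∨ false x w = refl
  not-∨ true true w = sym (∧-zeroʳ (not w))
  not-∨ true false w = sym (∧-identityʳ (not w))

allᶠ : ∀ {k} → (Fin k → Bool) → Bool
allᶠ {zero} f = true
allᶠ {suc k} f = f zero ∧ allᶠ (VF.tail f)

allᶠ⇒ : ∀ {k} (f : Fin k → Bool) → allᶠ f ≡ true → ∀ j → f j ≡ true
allᶠ⇒ {suc k} f e j with f zero in f0
allᶠ⇒ {suc k} f () j | false
allᶠ⇒ {suc k} f e zero | true = f0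
allᶠ⇒ {suc k} f e (suc j) | true = allᶠ⇒ (VF.tail f) e j

allInB≡allᶠ : ∀ {n k} (xs : Fin k → Fin n) (H : Subset n) → allInB xs H ≡ allᶠ (λ j → V.lookup H (xs j))
allInB≡allᶠ xs H = foldr-map-tabulate (λ j → V.lookup H (xs j)) (λ j → j)
  where
  foldr-map-tabulate : ∀ {A : Set} {k} (f : A → Bool) (h : Fin k → A) →
    L.foldr _∧_ true (L.map f (L.tabulate h)) ≡ allᶠ (λ j → f (h j))
  foldr-map-tabulate {k = zero} f h = refl
  foldr-map-tabulate {k = suc k} f h = cong (f (h zero) ∧_) (foldr-map-tabulate f (VF.tail h))

disjB⇒∉ : ∀ {n} (H HC : Subset n) → disjB H HC ≡ true → ∀ z → V.lookup H z ≡ true → V.lookup HC z ≡ false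
disjB⇒∉ (true ∷ H) (false ∷ HC) e zero h = refl
disjB⇒∉ (x ∷ H) (y ∷ HC) e (suc z) h = disjB⇒∉ H HC (∧-elimʳ (not (x ∧ y)) e) z h
  where
  ∧-elimʳ : ∀ u {w} → u ∧ w ≡ true → w ≡ true
  ∧-elimʳ true e = e

lookup-∉ : ∀ {n k} (HC : Subset n) (xs : Fin k → Fin n) → (∀ j → xs j ∉ HC) → ∀ j → V.lookup HC (xs j) ≡ false
lookup-∉ HC xs xs∉HC j with V.lookup HC (xs j) in e
... | true = ⊥-elim (xs∉HC j (lookup⇒[]= (xs j) HC e))
... | false = refl

∉-lookup : ∀ {n k} (HC : Subset n) (xs : Fin k → Fin n) → (∀ j → V.lookup HC (xs j) ≡ false) → ∀ j → xs j ∉ HC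
∉-lookup HC xs xs∉HC j m with trans (sym ([]=⇒lookup m)) (xs∉HC j)
... | ()

C-suc-* : ∀ m k → (m C suc k) * suc k ≡ (m C k) * (m ∸ k)
C-suc-* zero k = sym (trans (cong ((0 C k) *_) (ℕP.0∸n≡0 k)) (ℕP.*-zeroʳ (0 C k)))
C-suc-* (suc m) zero = trans (ℕP.*-identityʳ _) (trans (nC1≡n (suc m)) (sym (ℕP.+-identityʳ (suc m))))
C-suc-* (suc m) (suc k) = begin
  (suc m C suc (suc k)) * suc (suc k)
    ≡⟨ cong (_* suc (suc k)) (nCk+nC[k+1]≡[n+1]C[k+1] m (suc k)) ⟨
  (m C suc k + m C suc (suc k)) * suc (suc k)
    ≡⟨ ℕP.*-distribʳ-+ (suc (suc k)) (m C suc k) (m C suc (suc k)) ⟩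
  (m C suc k) * suc (suc k) + (m C suc (suc k)) * suc (suc k)
    ≡⟨ cong ((m C suc k) * suc (suc k) +_) (C-suc-* m (suc k)) ⟩
  (m C suc k) * suc (suc k) + (m C suc k) * (m ∸ suc k)
    ≡⟨ ℕP.*-distribˡ-+ (m C suc k) (suc (suc k)) (m ∸ suc k) ⟨
  (m C suc k) * (suc (suc k) + (m ∸ suc k))
    ≡⟨ weights ⟩
  (m C suc k) * (suc k + (m ∸ k))
    ≡⟨ ℕP.*-distribˡ-+ (m C suc k) (suc k) (m ∸ k) ⟩
  (m C suc k) * suc k + (m C suc k) * (m ∸ k)
    ≡⟨ cong (_+ (m C suc k) * (m ∸ k)) (C-suc-* m k) ⟩
  (m C k) * (m ∸ k) + (m C suc k) * (m ∸ k)
    ≡⟨ ℕP.*-distribʳ-+ (m ∸ k) (m C k) (m C suc k) ⟨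
  (m C k + m C suc k) * (m ∸ k)
    ≡⟨ cong (_* (m ∸ k)) (nCk+nC[k+1]≡[n+1]C[k+1] m k) ⟩
  (suc m C suc k) * (m ∸ k)
    ∎
  where
  open ≡-Reasoning
  -- both weights are m + 1 when k < m; otherwise m C (k + 1) vanishes
  weights : (m C suc k) * (suc (suc k) + (m ∸ suc k)) ≡ (m C suc k) * (suc k + (m ∸ k))
  weights with k ℕ.<? m
  ... | yes k<m = cong ((m C suc k) *_) (trans (sym (ℕP.+-suc (suc k) _)) (cong (suc k +_) (sym (ℕP.+-∸-assoc 1 k<m))))
  ... | no k≮m = trans (cong (_* (suc (suc k) + (m ∸ suc k))) mC[1+k]≡0) (sym (cong (_* (suc k + (m ∸ k))) mC[1+k]≡0))
    where
    mC[1+k]≡0 : m C suc k ≡ 0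
    mC[1+k]≡0 = k>n⇒nCk≡0 (s≤s (ℕP.≮⇒≥ k≮m))

C-pos : ∀ m k → k ≤ m → ∃[ B ] (m C k ≡ suc B)
C-pos m zero k≤m = 0 , refl
C-pos (suc m) (suc k) (s≤s k≤m) with C-pos m k k≤m
... | B , mCk≡1+B = B + m C suc k , trans (sym (nCk+nC[k+1]≡[n+1]C[k+1] m k)) (cong (_+ m C suc k) mCk≡1+B)

-- Double counting

module DoubleCounting {n a : ℕ} (HC : Subset n) (Hs : List (Subset n)) (A? : Subset n → Bool)
  (A?⇒ : ∀ H → A? H ≡ true → ∣ H ∣ ≡ a × disjB H HC ≡ true) where

  N : ∀ {k} → (Fin k → Fin n) → ℕ
  N ys = count (λ H → A? H ∧ allᶠ (λ j → V.lookup H (ys j))) Hs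

  fresh : ∀ {k} → (Fin k → Fin n) → Fin n → Bool
  fresh ys z = not (V.lookup HC z) ∧ not (z ∈ᵇ ys)

  Avoids : ∀ {k} → (Fin k → Fin n) → Set
  Avoids ys = ∀ j → V.lookup HC (ys j) ≡ false

  Σ-extensions : ∀ {k} (ys : Fin k → Fin n) → Injective _≡_ _≡_ ys →
    Σᶠ (λ z → [ fresh ys z ] * N (z VF.∷ ys)) ≡ N ys * (a ∸ k)
  Σ-extensions {k} ys inj = begin
    Σᶠ (λ z → [ fresh ys z ] * N (z VF.∷ ys))
      ≡⟨ Σᶠ-cong (λ z → count-∧ˡ (fresh ys z) (λ H → A? H ∧ in? H (z VF.∷ ys)) Hs) ⟩
    Σᶠ (λ z → count (λ H → fresh ys z ∧ (A? H ∧ (V.lookup H z ∧ in? H ys))) Hs)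
      ≡⟨ Σᶠ-Σᴸ-comm (λ z H → [ fresh ys z ∧ (A? H ∧ (V.lookup H z ∧ in? H ys)) ]) Hs ⟩
    Σᴸ (λ H → countᶠ (λ z → fresh ys z ∧ (A? H ∧ (V.lookup H z ∧ in? H ys)))) Hs
      ≡⟨ Σᴸ-cong extensions-in Hs ⟩
    Σᴸ (λ H → [ A? H ∧ in? H ys ] * (a ∸ k)) Hs
      ≡⟨ Σᴸ-*ʳ (λ H → A? H ∧ in? H ys) (a ∸ k) Hs ⟩
    N ys * (a ∸ k)
      ∎
    where
    open ≡-Reasoning
    in? : ∀ {k} → Subset n → (Fin k → Fin n) → Bool
    in? H ys = allᶠ (λ j → V.lookup H (ys j))
    extensions-in : ∀ H → countᶠ (λ z → fresh ys z ∧ (A? H ∧ (V.lookup H z ∧ in? H ys))) ≡ [ A? H ∧ in? H ys ] * (a ∸ k)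
    extensions-in H with A? H in A?H | in? H ys in ys⊆H
    ... | false | _ = Σᶠ-zero (λ z → cong [_] (∧-zeroʳ (fresh ys z)))
    ... | true | false = Σᶠ-zero (λ z → cong [_] (trans (cong (fresh ys z ∧_) (∧-zeroʳ (V.lookup H z))) (∧-zeroʳ (fresh ys z))))
    ... | true | true = begin
      countᶠ (λ z → fresh ys z ∧ (true ∧ (V.lookup H z ∧ true)))
        ≡⟨ Σᶠ-cong (λ z → cong [_] (fresh-in z)) ⟩
      countᶠ (λ z → V.lookup H z ∧ not (z ∈ᵇ ys))
        ≡⟨ ℕP.m+n∸n≡m _ k ⟨
      countᶠ (λ z → V.lookup H z ∧ not (z ∈ᵇ ys)) + k ∸ k
        ≡⟨ cong (_∸ k) (countᶠ-∖-distinct (V.lookup H) ys inj (allᶠ⇒ (λ j → V.lookup H (ys j)) ys⊆H)) ⟩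
      countᶠ (V.lookup H) ∸ k
        ≡⟨ cong (_∸ k) (trans (sym (∣∣≡countᶠ H)) (proj₁ (A?⇒ H A?H))) ⟩
      a ∸ k
        ≡⟨ ℕP.+-identityʳ _ ⟨
      [ true ] * (a ∸ k)
        ∎
      where
      fresh-in : ∀ z → fresh ys z ∧ (true ∧ (V.lookup H z ∧ true)) ≡ V.lookup H z ∧ not (z ∈ᵇ ys)
      fresh-in z with V.lookup H z in z∈H
      ... | false = ∧-zeroʳ (fresh ys z)
      ... | true rewrite disjB⇒∉ H HC (proj₂ (A?⇒ H A?H)) z z∈H = ∧-identityʳ (not (z ∈ᵇ ys))

  countᶠ-fresh : ∀ {k} (ys : Fin k → Fin n) → Injective _≡_ _≡_ ys → Avoids ys → countᶠ (fresh ys) + k + ∣ HC ∣ ≡ n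
  countᶠ-fresh ys inj avoids = begin
    countᶠ (fresh ys) + _ + ∣ HC ∣
      ≡⟨ cong₂ _+_ (countᶠ-∖-distinct (λ z → not (V.lookup HC z)) ys inj (λ j → cong not (avoids j))) (∣∣≡countᶠ HC) ⟩
    countᶠ (λ z → not (V.lookup HC z)) + countᶠ (V.lookup HC)
      ≡⟨ ℕP.+-comm (countᶠ (λ z → not (V.lookup HC z))) _ ⟩
    countᶠ (V.lookup HC) + countᶠ (λ z → not (V.lookup HC z))
      ≡⟨ countᶠ-not (V.lookup HC) ⟩
    n ∎
    where open ≡-Reasoning

  fresh⇒ : ∀ {k} (ys : Fin k → Fin n) z → fresh ys z ≡ true → V.lookup HC z ≡ false × z ∈ᵇ ys ≡ false
  fresh⇒ ys z e with V.lookup HC z | z ∈ᵇ ys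
  fresh⇒ ys z e | false | false = refl , refl

  Uniform : ℕ → ℕ → ℕ → Set
  Uniform M P k = ∀ (ys : Fin k → Fin n) → Injective _≡_ _≡_ ys → Avoids ys → N ys * (M C k) ≡ (a C k) * P

  uniform-pred : ∀ {b c} P k → a + b + c ≡ n → ∣ HC ∣ ≡ c → suc k ≤ a →
    Uniform (a + b) P (suc k) → Uniform (a + b) P k
  uniform-pred {b} {c} P k a+b+c≡n ∣HC∣≡c k<a uniform ys inj avoids =
    ℕP.*-cancelʳ-≡ _ _ (M ∸ k) {{ℕ.>-nonZero (ℕP.m<n⇒0<n∸m k<M)}}
      (ℕP.*-cancelʳ-≡ _ _ (a ∸ k) {{ℕ.>-nonZero (ℕP.m<n⇒0<n∸m k<a)}} (begin
        N ys * (M C k) * (M ∸ k) * (a ∸ k)          ≡⟨ r₁ (N ys) (M C k) (M ∸ k) (a ∸ k) ⟩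
        N ys * (a ∸ k) * ((M C k) * (M ∸ k))        ≡⟨ cong (N ys * (a ∸ k) *_) (C-suc-* M k) ⟨
        N ys * (a ∸ k) * ((M C suc k) * suc k)      ≡⟨ ℕP.*-assoc (N ys * (a ∸ k)) (M C suc k) (suc k) ⟨
        N ys * (a ∸ k) * (M C suc k) * suc k        ≡⟨ cong (_* suc k) count-extensions ⟩
        (M ∸ k) * ((a C suc k) * P) * suc k         ≡⟨ r₂ (M ∸ k) (a C suc k) P (suc k) ⟩
        (M ∸ k) * P * ((a C suc k) * suc k)         ≡⟨ cong ((M ∸ k) * P *_) (C-suc-* a k) ⟩
        (M ∸ k) * P * ((a C k) * (a ∸ k))           ≡⟨ r₃ (M ∸ k) P (a C k) (a ∸ k) ⟩
        (a C k) * P * (M ∸ k) * (a ∸ k)             ∎))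
    where
    open ≡-Reasoning
    M = a + b
    k<M : k < M
    k<M = ℕP.≤-trans k<a (ℕP.m≤m+n a b)
    r₁ : ∀ x y u v → x * y * u * v ≡ x * v * (y * u)
    r₁ = ℕSolver.solve-∀
    r₂ : ∀ x y u v → x * (y * u) * v ≡ x * u * (y * v)
    r₂ = ℕSolver.solve-∀
    r₃ : ∀ x y u v → x * y * (u * v) ≡ u * y * x * v
    r₃ = ℕSolver.solve-∀
    countᶠ-fresh≡M∸k : countᶠ (fresh ys) ≡ M ∸ k
    countᶠ-fresh≡M∸k = trans (sym (ℕP.m+n∸n≡m _ k)) (cong (_∸ k) (ℕP.+-cancelʳ-≡ c _ _
      (trans (cong (countᶠ (fresh ys) + k +_) (sym ∣HC∣≡c)) (trans (countᶠ-fresh ys inj avoids) (sym a+b+c≡n)))))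
    extend : ∀ z → [ fresh ys z ] * N (z VF.∷ ys) * (M C suc k) ≡ [ fresh ys z ] * ((a C suc k) * P)
    extend z with fresh ys z in fresh-z
    ... | false = refl
    ... | true = trans (cong (_* (M C suc k)) (ℕP.*-identityˡ (N (z VF.∷ ys))))
                   (trans (uniform (z VF.∷ ys) (∷-injective z ys inj (proj₂ z-fresh)) z∷ys-avoids)
                          (sym (ℕP.*-identityˡ _)))
      where
      z-fresh = fresh⇒ ys z fresh-z
      z∷ys-avoids : Avoids (z VF.∷ ys)
      z∷ys-avoids zero = proj₁ z-fresh
      z∷ys-avoids (suc j) = avoids j
    count-extensions : N ys * (a ∸ k) * (M C suc k) ≡ (M ∸ k) * ((a C suc k) * P)
    count-extensions = begin
      N ys * (a ∸ k) * (M C suc k)                              ≡⟨ cong (_* (M C suc k)) (Σ-extensions ys inj) ⟨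
      Σᶠ (λ z → [ fresh ys z ] * N (z VF.∷ ys)) * (M C suc k)    ≡⟨ Σᶠ-*ʳ (λ z → [ fresh ys z ] * N (z VF.∷ ys)) (M C suc k) ⟨
      Σᶠ (λ z → [ fresh ys z ] * N (z VF.∷ ys) * (M C suc k))    ≡⟨ Σᶠ-cong extend ⟩
      Σᶠ (λ z → [ fresh ys z ] * ((a C suc k) * P))             ≡⟨ Σᶠ-*ʳ (λ z → [ fresh ys z ]) ((a C suc k) * P) ⟩
      countᶠ (fresh ys) * ((a C suc k) * P)                     ≡⟨ cong (_* ((a C suc k) * P)) countᶠ-fresh≡M∸k ⟩
      (M ∸ k) * ((a C suc k) * P)                               ∎

  uniform-≤′ : ∀ {b c} P {δ' δ} → a + b + c ≡ n → ∣ HC ∣ ≡ c → δ' ℕ.≤′ δ → δ ≤ a →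
    Uniform (a + b) P δ → Uniform (a + b) P δ'
  uniform-≤′ P a+b+c≡n ∣HC∣≡c ℕ.≤′-refl δ≤a uniform = uniform
  uniform-≤′ P a+b+c≡n ∣HC∣≡c (ℕ.≤′-step {δ} δ'≤′δ) 1+δ≤a uniform =
    uniform-≤′ P a+b+c≡n ∣HC∣≡c δ'≤′δ (ℕP.≤-trans (ℕP.n≤1+n δ) 1+δ≤a)
      (uniform-pred P δ a+b+c≡n ∣HC∣≡c 1+δ≤a uniform)

𝟙 : Bool → ℚ
𝟙 true = 1ℚ
𝟙 false = 0ℚ

module _ {A : Set} where

  sumℚ-cong : {f g : A → ℚ} → (∀ x → f x ≡ g x) → (xs : List A) → sumℚ (L.map f xs) ≡ sumℚ (L.map g xs)
  sumℚ-cong e [] = refl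
  sumℚ-cong e (x ∷ xs) = cong₂ Q._+_ (e x) (sumℚ-cong e xs)

  sumℚ-filter-cong : {P : A → Set} (D : ∀ x → Dec (P x)) {f g : A → ℚ} → (∀ x → P x → f x ≡ g x) →
    (xs : List A) → sumℚ (L.map f (filter D xs)) ≡ sumℚ (L.map g (filter D xs))
  sumℚ-filter-cong D e [] = refl
  sumℚ-filter-cong D e (x ∷ xs) with D x
  ... | yes p = cong₂ Q._+_ (e x p) (sumℚ-filter-cong D e xs)
  ... | no _ = sumℚ-filter-cong D e xs

  sumℚ-𝟙 : (f : A → Bool) (q : ℚ) (xs : List A) → sumℚ (L.map (λ x → 𝟙 (f x) Q.* q) xs) ≡ toℚ (count f xs) Q.* q
  sumℚ-𝟙 f q [] = sym (QP.*-zeroˡ q)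
  sumℚ-𝟙 f q (x ∷ xs) = begin
    𝟙 (f x) Q.* q Q.+ sumℚ (L.map (λ x → 𝟙 (f x) Q.* q) xs)  ≡⟨ cong (𝟙 (f x) Q.* q Q.+_) (sumℚ-𝟙 f q xs) ⟩
    𝟙 (f x) Q.* q Q.+ toℚ (count f xs) Q.* q                ≡⟨ QP.*-distribʳ-+ q (𝟙 (f x)) (toℚ (count f xs)) ⟨
    (𝟙 (f x) Q.+ toℚ (count f xs)) Q.* q                    ≡⟨ cong (λ t → (t Q.+ toℚ (count f xs)) Q.* q) (𝟙≡toℚ (f x)) ⟩
    (toℚ [ f x ] Q.+ toℚ (count f xs)) Q.* q                ≡⟨ cong (Q._* q) (toℚ-+ [ f x ] (count f xs)) ⟨
    toℚ (count f (x ∷ xs)) Q.* q                            ∎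
    where
    open ≡-Reasoning
    𝟙≡toℚ : ∀ b → 𝟙 b ≡ toℚ [ b ]
    𝟙≡toℚ true = refl
    𝟙≡toℚ false = refl

sumℚ-tabulate-≟ : ∀ {m} (i : Fin m) (B : Bool) (f : Fin m → ℚ) →
  sumℚ (L.tabulate (λ j → 𝟙 (⌊ i F.≟ j ⌋ ∧ B) Q.* f j)) ≡ 𝟙 B Q.* f i
sumℚ-tabulate-≟ {suc m} zero B f =
  trans (cong (𝟙 B Q.* f zero Q.+_) (sumℚ-zeros (λ j → QP.*-zeroˡ (f (suc j))))) (QP.+-identityʳ _)
  where
  sumℚ-zeros : ∀ {m} {g : Fin m → ℚ} → (∀ j → g j ≡ 0ℚ) → sumℚ (L.tabulate g) ≡ 0ℚ
  sumℚ-zeros {zero} e = refl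
  sumℚ-zeros {suc m} e = trans (cong₂ Q._+_ (e zero) (sumℚ-zeros (λ j → e (suc j)))) (QP.+-identityʳ 0ℚ)
sumℚ-tabulate-≟ {suc m} (suc i) B f = trans (cong₂ Q._+_ (QP.*-zeroˡ (f zero))
  (trans (cong sumℚ (LP.tabulate-cong (λ j → cong (λ t → 𝟙 (t ∧ B) Q.* f (suc j)) (⌊⌋-map′ (cong suc) FP.suc-injective (i F.≟ j)))))
         (sumℚ-tabulate-≟ i B (λ j → f (suc j)))))
  (QP.+-identityˡ _)

-- Conditional probabilities of an equitable strategy

module Probability {n a : ℕ} (S : Strategy n a) {γ : ℕ} (equitable : Equitable S γ) (b c : ℕ) where
  open Strategy S

  γ*prob≡1 : ∀ H → ∣ H ∣ ≡ a → ∀ i → T (ann i H) → toℚ γ Q.* prob H i ≡ 1ℚ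
  γ*prob≡1 H ∣H∣≡a i H∈𝒜ᵢ = begin
    toℚ γ Q.* prob H i                                          ≡⟨ cong (λ k → toℚ k Q.* prob H i) (proj₁ (equitable H ∣H∣≡a)) ⟨
    toℚ (length (g S H)) Q.* prob H i                           ≡⟨ cong (λ k → toℚ k Q.* prob H i) (length-filter-T (λ j → ann j H) _ (L.allFin m)) ⟩
    toℚ (count (λ j → ann j H) (L.allFin m)) Q.* prob H i        ≡⟨ sumℚ-𝟙 (λ j → ann j H) (prob H i) (L.allFin m) ⟨
    sumℚ (L.map (λ j → 𝟙 (ann j H) Q.* prob H i) (L.allFin m))  ≡⟨ sumℚ-cong uniform (L.allFin m) ⟨
    sumℚ (L.map (prob H) (L.allFin m))                          ≡⟨ prob-sum H ∣H∣≡a ⟩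
    1ℚ                                                          ∎
    where
    open ≡-Reasoning
    uniform : ∀ j → prob H j ≡ 𝟙 (ann j H) Q.* prob H i
    uniform j with ann j H in H∈𝒜ⱼ
    ... | true = trans (proj₂ (equitable H ∣H∣≡a) j i (subst T (sym H∈𝒜ⱼ) tt) H∈𝒜ᵢ) (sym (QP.*-identityˡ (prob H i)))
    ... | false = trans (prob-zero H ∣H∣≡a j (subst T H∈𝒜ⱼ)) (sym (QP.*-zeroˡ (prob H i)))

  prob-constant : ∀ i {H H'} → ∣ H ∣ ≡ a → ∣ H' ∣ ≡ a → T (ann i H) → T (ann i H') → prob H' i ≡ prob H i
  prob-constant i {H} {H'} ∣H∣≡a ∣H'∣≡a H∈𝒜ᵢ H'∈𝒜ᵢ = *-cancelʳ-≡ (prob H' i) (prob H i) (toℚ γ) γ≢0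
    (trans (QP.*-comm (prob H' i) (toℚ γ)) (trans (γ*prob≡1 H' ∣H'∣≡a i H'∈𝒜ᵢ)
      (trans (sym (γ*prob≡1 H ∣H∣≡a i H∈𝒜ᵢ)) (QP.*-comm (toℚ γ) (prob H i)))))
    where
    γ≢0 : toℚ γ ≢ 0ℚ
    γ≢0 γ≡0 = QP.1≢0 (trans (sym (γ*prob≡1 H ∣H∣≡a i H∈𝒜ᵢ)) (trans (cong (Q._* prob H i) γ≡0) (QP.*-zeroˡ (prob H i))))

  Pr-announced : ∀ i (B : Owners n → Bool) p → (∀ H → ∣ H ∣ ≡ a → T (ann i H) → prob H i ≡ p) →
    Pr S b c (λ d j → ⌊ i F.≟ j ⌋ ∧ B d)
      ≡ toℚ (count (λ d → B d ∧ ann i (handA d)) (deals n a b c)) Q.* (ratio 1 (length (deals n a b c)) Q.* p)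
  Pr-announced i B p prob≡p = trans (sumℚ-filter-cong (sized? a b c) per-deal (allOwners n))
    (sumℚ-𝟙 (λ d → B d ∧ ann i (handA d)) (r Q.* p) (deals n a b c))
    where
    r = ratio 1 (length (deals n a b c))
    per-deal : ∀ d → (∣ handA d ∣ ≡ a) × ((∣ handB d ∣ ≡ b) × (∣ handC d ∣ ≡ c)) →
      sumℚ (L.map (λ j → ind S b c (⌊ i F.≟ j ⌋ ∧ B d) Q.* (r Q.* prob (handA d) j)) (L.allFin m))
        ≡ 𝟙 (B d ∧ ann i (handA d)) Q.* (r Q.* p)
    per-deal d (∣A∣≡a , _) = begin
      sumℚ (L.map (λ j → ind S b c (⌊ i F.≟ j ⌋ ∧ B d) Q.* (r Q.* prob (handA d) j)) (L.allFin m))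
        ≡⟨ cong sumℚ (trans (LP.map-tabulate (λ j → j) _) (LP.tabulate-cong (λ j → cong (Q._* _) (ind≡𝟙 (⌊ i F.≟ j ⌋ ∧ B d))))) ⟩
      sumℚ (L.tabulate (λ j → 𝟙 (⌊ i F.≟ j ⌋ ∧ B d) Q.* (r Q.* prob (handA d) j)))
        ≡⟨ sumℚ-tabulate-≟ i (B d) (λ j → r Q.* prob (handA d) j) ⟩
      𝟙 (B d) Q.* (r Q.* prob (handA d) i)
        ≡⟨ announced ⟩
      𝟙 (B d ∧ ann i (handA d)) Q.* (r Q.* p)
        ∎
      where
      open ≡-Reasoning
      ind≡𝟙 : ∀ x → ind S b c x ≡ 𝟙 x
      ind≡𝟙 true = refl
      ind≡𝟙 false = refl
      announced : 𝟙 (B d) Q.* (r Q.* prob (handA d) i) ≡ 𝟙 (B d ∧ ann i (handA d)) Q.* (r Q.* p)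
      announced with ann i (handA d) in A∈𝒜ᵢ
      ... | true = cong₂ (λ u v → 𝟙 u Q.* (r Q.* v)) (sym (∧-identityʳ (B d))) (prob≡p (handA d) ∣A∣≡a (subst T (sym A∈𝒜ᵢ) tt))
      ... | false = begin
        𝟙 (B d) Q.* (r Q.* prob (handA d) i)    ≡⟨ cong (λ v → 𝟙 (B d) Q.* (r Q.* v)) (prob-zero (handA d) ∣A∣≡a i (subst T A∈𝒜ᵢ)) ⟩
        𝟙 (B d) Q.* (r Q.* 0ℚ)                  ≡⟨ cong (𝟙 (B d) Q.*_) (QP.*-zeroʳ r) ⟩
        𝟙 (B d) Q.* 0ℚ                          ≡⟨ QP.*-zeroʳ (𝟙 (B d)) ⟩
        0ℚ                                      ≡⟨ QP.*-zeroˡ (r Q.* p) ⟨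
        𝟙 false Q.* (r Q.* p)                   ≡⟨ cong (λ u → 𝟙 u Q.* (r Q.* p)) (∧-zeroʳ (B d)) ⟨
        𝟙 (B d ∧ false) Q.* (r Q.* p)           ∎

  UniformCount : Subset n → Fin m → ℕ → Set
  UniformCount HC i k = ∀ (xs : Fin k → Fin n) → Injective _≡_ _≡_ xs → (∀ j → xs j ∉ HC) →
    count𝒫 S HC i xs * ((a + b) C k) ≡ (a C k) * length (𝒫 S HC i)

  module _ (a+b+c≡n : a + b + c ≡ n) (HC : Subset n) (∣HC∣≡c : ∣ HC ∣ ≡ c) (i : Fin m) where

    count-announced : (R : Subset n → Bool) →
      count (λ d → (eqB (handC d) HC ∧ R (handA d)) ∧ ann i (handA d)) (deals n a b c)
        ≡ count (λ H → (ann i H ∧ disjB H HC) ∧ R H) (allSubsets n)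
    count-announced R = begin
      count (λ d → (eqB (handC d) HC ∧ R (handA d)) ∧ ann i (handA d)) (deals n a b c)
        ≡⟨ count-cong (λ d → ∧-rotate (eqB (handC d) HC) (R (handA d)) (ann i (handA d))) (deals n a b c) ⟩
      count (λ d → eqB (handC d) HC ∧ (ann i (handA d) ∧ R (handA d))) (deals n a b c)
        ≡⟨ count-deals≡count-hands HC (λ H → ann i H ∧ R H) a+b+c≡n ∣HC∣≡c announced⇒size ⟩
      count (λ H → disjB H HC ∧ (ann i H ∧ R H)) (allSubsets n)
        ≡⟨ count-cong (λ H → ∧-swap (disjB H HC) (ann i H) (R H)) (allSubsets n) ⟩
      count (λ H → (ann i H ∧ disjB H HC) ∧ R H) (allSubsets n)
        ∎
      where
      open ≡-Reasoning
      ∧-rotate : ∀ x y z → (x ∧ y) ∧ z ≡ x ∧ (z ∧ y)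
      ∧-rotate false y z = refl
      ∧-rotate true y false = ∧-zeroʳ y
      ∧-rotate true y true = ∧-identityʳ y
      ∧-swap : ∀ x y z → x ∧ (y ∧ z) ≡ (y ∧ x) ∧ z
      ∧-swap false y z = sym (cong (_∧ z) (∧-zeroʳ y))
      ∧-swap true y z = cong (_∧ z) (sym (∧-identityʳ y))
      announced⇒size : ∀ H → ann i H ∧ R H ≡ true → ∣ H ∣ ≡ a
      announced⇒size H e with ann i H in H∈𝒜ᵢ
      ... | true = ann-size i H (subst T (sym H∈𝒜ᵢ) tt)

    length-𝒫 : length (𝒫 S HC i) ≡ count (λ H → ann i H ∧ disjB H HC) (allSubsets n)
    length-𝒫 = length-filter-T (λ H → ann i H ∧ disjB H HC) _ (allSubsets n)

    count𝒫≡ : ∀ {k} (xs : Fin k → Fin n) → count𝒫 S HC i xs ≡ count (λ H → (ann i H ∧ disjB H HC) ∧ allInB xs H) (allSubsets n)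
    count𝒫≡ xs = trans (length-filter-T (allInB xs) _ (𝒫 S HC i))
      (count-filter-T (λ H → ann i H ∧ disjB H HC) _ (allInB xs) (allSubsets n))

    announced-hand : ∀ {Y} → length (𝒫 S HC i) ≡ suc Y → ∃[ H ] T (ann i H ∧ disjB H HC)
    announced-hand len with 𝒫 S HC i in 𝒫≡
    ... | H ∷ _ = H , filter-head _ (allSubsets n) 𝒫≡

    condPr-quotient : ∀ {k} (xs : Fin k → Fin n) {Y} → length (𝒫 S HC i) ≡ suc Y →
      condPr S b c xs i HC Q.* toℚ (suc Y) ≡ toℚ (count𝒫 S HC i xs)
    condPr-quotient xs {Y} ∣𝒫∣≡1+Y = begin
      divℚ (Pr S b c (λ d j → ⌊ i F.≟ j ⌋ ∧ eqB (handC d) HC ∧ allInB xs (handA d)))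
           (Pr S b c (λ d j → ⌊ i F.≟ j ⌋ ∧ eqB (handC d) HC)) Q.* toℚ (suc Y)
        ≡⟨ cong₂ (λ u v → divℚ u v Q.* toℚ (suc Y)) Pr-both Pr-given ⟩
      divℚ (toℚ (count𝒫 S HC i xs) Q.* w) (toℚ (suc Y) Q.* w) Q.* toℚ (suc Y)
        ≡⟨ divℚ-scaled (toℚ (count𝒫 S HC i xs)) (toℚ (suc Y)) w (toℚ-suc≢0 Y) w≢0 ⟩
      toℚ (count𝒫 S HC i xs)
        ∎
      where
      open ≡-Reasoning
      H₀ = proj₁ (announced-hand ∣𝒫∣≡1+Y)
      H₀∈𝒜ᵢ : T (ann i H₀)
      H₀∈𝒜ᵢ = T-∧ˡ (proj₂ (announced-hand ∣𝒫∣≡1+Y))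
        where
        T-∧ˡ : ∀ {x y} → T (x ∧ y) → T x
        T-∧ˡ {true} _ = tt
      ∣H₀∣≡a = ann-size i H₀ H₀∈𝒜ᵢ
      p₀ = prob H₀ i
      #deals = length (deals n a b c)
      w = ratio 1 #deals Q.* p₀
      count-given : count (λ d → eqB (handC d) HC ∧ ann i (handA d)) (deals n a b c) ≡ suc Y
      count-given = begin
        count (λ d → eqB (handC d) HC ∧ ann i (handA d)) (deals n a b c)
          ≡⟨ count-cong (λ d → cong (_∧ ann i (handA d)) (∧-identityʳ (eqB (handC d) HC))) (deals n a b c) ⟨
        count (λ d → (eqB (handC d) HC ∧ true) ∧ ann i (handA d)) (deals n a b c)
          ≡⟨ count-announced (λ _ → true) ⟩
        count (λ H → (ann i H ∧ disjB H HC) ∧ true) (allSubsets n)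
          ≡⟨ count-cong (λ H → ∧-identityʳ (ann i H ∧ disjB H HC)) (allSubsets n) ⟩
        count (λ H → ann i H ∧ disjB H HC) (allSubsets n)
          ≡⟨ trans (sym length-𝒫) ∣𝒫∣≡1+Y ⟩
        suc Y
          ∎
      w≢0 : w ≢ 0ℚ
      w≢0 = *-≢0 (ratio-1-≢0 (ℕP.≤-trans (s≤s z≤n) (subst (_≤ #deals) count-given (count≤length _ (deals n a b c)))))
        (λ p₀≡0 → QP.1≢0 (trans (sym (γ*prob≡1 H₀ ∣H₀∣≡a i H₀∈𝒜ᵢ)) (trans (cong (toℚ γ Q.*_) p₀≡0) (QP.*-zeroʳ (toℚ γ)))))
      prob≡p₀ : ∀ H → ∣ H ∣ ≡ a → T (ann i H) → prob H i ≡ p₀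
      prob≡p₀ H ∣H∣≡a H∈𝒜ᵢ = prob-constant i ∣H₀∣≡a ∣H∣≡a H₀∈𝒜ᵢ H∈𝒜ᵢ
      Pr-both : Pr S b c (λ d j → ⌊ i F.≟ j ⌋ ∧ eqB (handC d) HC ∧ allInB xs (handA d)) ≡ toℚ (count𝒫 S HC i xs) Q.* w
      Pr-both = trans (Pr-announced i (λ d → eqB (handC d) HC ∧ allInB xs (handA d)) p₀ prob≡p₀)
        (cong (λ k → toℚ k Q.* w) (trans (count-announced (allInB xs)) (sym (count𝒫≡ xs))))
      Pr-given : Pr S b c (λ d j → ⌊ i F.≟ j ⌋ ∧ eqB (handC d) HC) ≡ toℚ (suc Y) Q.* w
      Pr-given = trans (Pr-announced i (λ d → eqB (handC d) HC) p₀ prob≡p₀) (cong (λ k → toℚ k Q.* w) count-given)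

    length-𝒫-suc : 𝒫 S HC i ≢ [] → ∃[ Y ] (length (𝒫 S HC i) ≡ suc Y)
    length-𝒫-suc 𝒫≢[] with 𝒫 S HC i
    ... | [] = ⊥-elim (𝒫≢[] refl)
    ... | _ ∷ Hs = length Hs , refl

    module _ (𝒫≢[] : 𝒫 S HC i ≢ []) {k} (xs : Fin k → Fin n) where
      private
        Y = proj₁ (length-𝒫-suc 𝒫≢[])
        ∣𝒫∣≡1+Y = proj₂ (length-𝒫-suc 𝒫≢[])
        X = count𝒫 S HC i xs
        q = condPr S b c xs i HC
      open Quotient X Y q (condPr-quotient xs ∣𝒫∣≡1+Y)

      weakly-secure⇔ : (0ℚ Q.< q × q Q.< 1ℚ) ⇔ (1 ≤ X × X ≤ length (𝒫 S HC i) ∸ 1)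
      weakly-secure⇔ = 0<q⇔1≤X ×-⇔ subst (λ L → q Q.< 1ℚ ⇔ X ≤ L ∸ 1) (sym ∣𝒫∣≡1+Y) q<1⇔X≤Y

      perfectly-secure⇔ : k ≤ a + b → q ≡ ratio (a C k) ((a + b) C k) ⇔ X * ((a + b) C k) ≡ (a C k) * length (𝒫 S HC i)
      perfectly-secure⇔ k≤a+b = subst₂ (λ D L → q ≡ ratio (a C k) D ⇔ X * D ≡ (a C k) * L)
        (sym (proj₂ (C-pos (a + b) k k≤a+b))) (sym ∣𝒫∣≡1+Y) (q≡ratio⇔ (a C k) (proj₁ (C-pos (a + b) k k≤a+b)))

    uniformCount-≤ : ∀ {δ' δ} → δ' ≤ δ → δ ≤ a → UniformCount HC i δ →
      ∀ (xs : Fin δ' → Fin n) → Injective _≡_ _≡_ xs → (∀ j → xs j ∉ HC) →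
      count𝒫 S HC i xs * ((a + b) C δ') ≡ (a C δ') * length (𝒫 S HC i)
    uniformCount-≤ δ'≤δ δ≤a uniform xs inj xs∉HC =
      subst (λ t → t * _ ≡ _) (sym (count𝒫≡N xs))
        (uniform-≤′ (length (𝒫 S HC i)) a+b+c≡n ∣HC∣≡c (ℕP.≤⇒≤′ δ'≤δ) δ≤a
          (λ ys inj' ys-avoid → subst (λ t → t * _ ≡ _) (count𝒫≡N ys) (uniform ys inj' (∉-lookup HC ys ys-avoid)))
          xs inj (lookup-∉ HC xs xs∉HC))
      where
      announced⇒ : ∀ H → ann i H ∧ disjB H HC ≡ true → ∣ H ∣ ≡ a × disjB H HC ≡ true
      announced⇒ H e with ann i H in H∈𝒜ᵢ | disjB H HC
      ... | true | true = ann-size i H (subst T (sym H∈𝒜ᵢ) tt) , refl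
      open DoubleCounting HC (allSubsets n) (λ H → ann i H ∧ disjB H HC) announced⇒
      count𝒫≡N : ∀ {k} (xs : Fin k → Fin n) → count𝒫 S HC i xs ≡ N xs
      count𝒫≡N xs = trans (count𝒫≡ xs) (count-cong (λ H → cong ((ann i H ∧ disjB H HC) ∧_) (allInB≡allᶠ xs H)) (allSubsets n))

theorem11 : (n a b c : ℕ) → 1 ≤ a → 1 ≤ b → 1 ≤ c → a + b + c ≡ n →
    (δ : ℕ) → 1 ≤ δ → δ ≤ a →
    (S : Strategy n a) → (γ : ℕ) → Equitable S γ →
    (WeaklySecure S b c δ ⇔
      (∀ δ' → 1 ≤ δ' → δ' ≤ δ → ∀ i → ∀ (HC : Subset n) → ∣ HC ∣ ≡ c →
        𝒫 S HC i ≢ [] → ∀ (xs : Fin δ' → Fin n) → Injective _≡_ _≡_ xs → (∀ j → xs j ∉ HC) →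
        1 ≤ count𝒫 S HC i xs × count𝒫 S HC i xs ≤ length (𝒫 S HC i) ∸ 1))
    × (PerfectlySecure S b c δ ⇔
      (∀ i → ∀ (HC : Subset n) → ∣ HC ∣ ≡ c →
        𝒫 S HC i ≢ [] → ∀ (xs : Fin δ → Fin n) → Injective _≡_ _≡_ xs → (∀ j → xs j ∉ HC) →
        count𝒫 S HC i xs * ((a + b) C δ) ≡ (a C δ) * length (𝒫 S HC i)))
theorem11 n a b c _ _ _ a+b+c≡n δ 1≤δ δ≤a S γ equitable =
  mk⇔ (λ weak δ' 1≤δ' δ'≤δ i HC ∣HC∣≡c 𝒫≢[] xs inj xs∉HC →
         Equivalence.to (weakly-secure⇔ a+b+c≡n HC ∣HC∣≡c i 𝒫≢[] xs) (weak δ' 1≤δ' δ'≤δ i HC ∣HC∣≡c 𝒫≢[] xs inj xs∉HC))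
      (λ counts δ' 1≤δ' δ'≤δ i HC ∣HC∣≡c 𝒫≢[] xs inj xs∉HC →
         Equivalence.from (weakly-secure⇔ a+b+c≡n HC ∣HC∣≡c i 𝒫≢[] xs) (counts δ' 1≤δ' δ'≤δ i HC ∣HC∣≡c 𝒫≢[] xs inj xs∉HC)) ,
  mk⇔ (λ perfect i HC ∣HC∣≡c 𝒫≢[] xs (inj : Injective _≡_ _≡_ xs) xs∉HC →
         Equivalence.to (perfectly-secure⇔ a+b+c≡n HC ∣HC∣≡c i 𝒫≢[] xs (≤a+b δ≤a))
           (perfect δ 1≤δ ℕP.≤-refl i HC ∣HC∣≡c 𝒫≢[] xs inj xs∉HC))
      (λ counts δ' _ δ'≤δ i HC ∣HC∣≡c 𝒫≢[] xs (inj : Injective _≡_ _≡_ xs) xs∉HC →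
         Equivalence.from (perfectly-secure⇔ a+b+c≡n HC ∣HC∣≡c i 𝒫≢[] xs (≤a+b (ℕP.≤-trans δ'≤δ δ≤a)))
           (uniformCount-≤ a+b+c≡n HC ∣HC∣≡c i δ'≤δ δ≤a (counts i HC ∣HC∣≡c 𝒫≢[]) xs inj xs∉HC))
  where
  open Probability S equitable b c
  ≤a+b : ∀ {k} → k ≤ a → k ≤ a + b
  ≤a+b k≤a = ℕP.≤-trans k≤a (ℕP.m≤m+n a b)
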